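{- Let $\mathbb E$ be the Eventually Different Real forcing notion and let $\pi_{\mathbb E}:\omega^{<\omega}\to\mathbb E$ be given by $\pi_{\mathbb E}(s)=(s,F_\emptyset)$, where $F_\emptyset(n)=\emptyset$ for all $n$. Then $\pi_{\mathbb E}$ is an index invariant, permutation invariant and productive basis for $\mathbb E$. Moreover, for all $p,q\in\mathbb E$: $\phi(p)\cap\phi(q)=\emptyset$ if and only if $p\perp q$.
   Context: $\mathbb E$ consists of pairs $(z,F)$ where $z$ is a finite function with $\mathrm{dom}(z)\subseteq\omega$ finite and values in $\omega$, and $F:\omega\to[\omega]^{<\omega}$ satisfies $\max\{|F(n)|:n\in\omega\}<\omega$. The order (stronger = greater): $(z,F)\le(z',F')$ iff $z\subseteq z'$, $F(n)\subseteq F'(n)$ for all $n$, and $z'(k)\notin F(k)$ for all $k\in\mathrm{dom}(z')\setminus\mathrm{dom}(z)$. $\perp$ denotes incompatibility. A basis for a forcing notion $\mathbb P$ with weakest element $\emptyset_{\mathbb P}$ is a map $\pi:\omega^{<\omega}\to\mathbb P$ such that each $\{\pi(s^\frown n):n\in\omega\}$ is a maximal antichain above $\pi(s)$ (pairwise incompatible conditions $\ge\pi(s)$, every condition $\ge\pi(s)$ compatible with one of them), $\pi(\langle\rangle)=\emptyset_{\mathbb P}$, and $\mathrm{rng}(\pi)$ is a set of $\sigma$-1-generators, i.e. for every $p$ and every $q\perp p$ there is $r\in\mathrm{rng}(\pi)$ with $r\perp p$ and $r$ compatible with $q$. For a basis $\pi$, $\phi(p)=\{x\in\omega^\omega:\forall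 n\ (\pi(x\restriction n)\text{ compatible with }p)\}$. $\pi$ is index invariant if for every permutation $P$ of $\omega$ there is an automorphism $a_P$ of $\mathbb P$ with $\phi(a_P(p))=\{x\circ P:x\in\phi(p)\}$ for all $p$; permutation invariant if for every sequence $\bar P=\langle P_n\rangle$ of permutations of $\omega$ there is an automorphism $a^{\bar P}$ with $\phi(a^{\bar P}(p))=\{\bar P(x):x\in\phi(p)\}$, where $\bar P(x)(n)=P_n(x(n))$; productive if for every infinite $K\subseteq\omega$, with $\mu_K:\omega\to K$ its increasing enumeration, there is a complete embedding $i_K:\mathbb P\to\mathbb P$ with $\phi(i_K(p))=\phi_K(p)\times\omega^{\omega\setminus K}$, where $\phi_K(p)=\{x\circ\mu_K^{ -1}:x\in\phi(p)\}\subseteq\omega^K$. -}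

module Defs where

open import Data.Nat using (ℕ; zero; suc; _≤_; _<_)
open import Data.List using (List; []; _∷_; _++_; [_]; length; map; upTo)
open import Data.List.Membership.Propositional using (_∈_)
open import Data.Maybe using (Maybe; just; nothing)
open import Data.Product using (Σ; ∃; _×_; _,_)
open import Data.Empty using (⊥)
open import Relation.Nullary using (¬_)
open import Relation.Binary.PropositionalEquality using (_≡_; _≢_)
open import Function.Bundles using (_↔_; Inverse; _⇔_)

-- A condition is (z , F): z a finite partial function ω ⇀ ω (encoded as
-- ℕ → Maybe ℕ with finite support), F : ω → [ω]^{<ω} (finite sets encoded
-- as lists, read up to membership) with uniformly bounded size.

record Cond : Set where
  constructor cond
  field
    z    : ℕ → Maybe ℕ
    zfin : ∃ λ N → ∀ n → N ≤ n → z n ≡ nothing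
    F    : ℕ → List ℕ
    Fbd  : ∃ λ m → ∀ n → length (F n) ≤ m
open Cond public

-- Order: p ≤E q means q is stronger than p.
_≤E_ : Cond → Cond → Set
p ≤E q =
    (∀ k v → z p k ≡ just v → z q k ≡ just v)
  × (∀ n x → x ∈ F p n → x ∈ F q n)
  × (∀ k v → z q k ≡ just v → z p k ≡ nothing → ¬ (v ∈ F p k))

_≈E_ : Cond → Cond → Set
p ≈E q = (p ≤E q) × (q ≤E p)

Compat : Cond → Cond → Set
Compat p q = ∃ λ r → (p ≤E r) × (q ≤E r)

Incompat : Cond → Cond → Set
Incompat p q = ¬ Compat p q

F∅ : ℕ → List ℕ
F∅ _ = []

emptyFun : ℕ → Maybe ℕ
emptyFun _ = nothing

seqFun : List ℕ → ℕ → Maybe ℕ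
seqFun []      k       = nothing
seqFun (a ∷ s) zero    = just a
seqFun (a ∷ s) (suc k) = seqFun s k

seqFun-fin : ∀ s n → length s ≤ n → seqFun s n ≡ nothing
seqFun-fin []      n       _           = _≡_.refl
seqFun-fin (a ∷ s) (suc n) (Data.Nat.s≤s h) = seqFun-fin s n h

F∅-bd : ∃ λ m → ∀ n → length (F∅ n) ≤ m
F∅-bd = 0 , λ _ → Data.Nat.z≤n

emptyCond : Cond
emptyCond = cond emptyFun (0 , λ _ _ → _≡_.refl) F∅ F∅-bd

πE : List ℕ → Cond
πE s = cond (seqFun s) (length s , seqFun-fin s) F∅ F∅-bd

restrict : (ℕ → ℕ) → ℕ → List ℕ
restrict x n = map x (upTo n)

record IsBasis (π : List ℕ → Cond) : Set where
  field
    root       : π [] ≈E emptyCond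
    above      : ∀ s n → π s ≤E π (s ++ [ n ])
    pairwise   : ∀ s n m → n ≢ m → Incompat (π (s ++ [ n ])) (π (s ++ [ m ]))
    maximal    : ∀ s q → π s ≤E q → ∃ λ n → Compat q (π (s ++ [ n ]))
    generators : ∀ p q → Incompat q p →
                 ∃ λ s → Incompat (π s) p × Compat (π s) q

φ : (List ℕ → Cond) → Cond → (ℕ → ℕ) → Set
φ π p x = ∀ n → Compat (π (restrict x n)) p

record Automorphism : Set where
  field
    to       : Cond → Cond
    from     : Cond → Cond
    to-from  : ∀ p → to (from p) ≈E p
    from-to  : ∀ p → from (to p) ≈E p
    mono     : ∀ p q → p ≤E q → to p ≤E to q
    reflect  : ∀ p q → to p ≤E to q → p ≤E q
open Automorphism public

record IsCompleteEmbedding (i : Cond → Cond) : Set where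
  field
    mono      : ∀ p q → p ≤E q → i p ≤E i q
    incompat  : ∀ p q → Incompat p q → Incompat (i p) (i q)
    reduction : ∀ q → ∃ λ p → ∀ p' → p ≤E p' → Compat (i p') q

_≐_ : ((ℕ → ℕ) → Set) → ((ℕ → ℕ) → Set) → Set
A ≐ B = ∀ y → (A y → B y) × (B y → A y)

IndexInvariant : (List ℕ → Cond) → Set
IndexInvariant π =
  (P : ℕ ↔ ℕ) → Σ Automorphism λ a → ∀ p →
    φ π (to a p) ≐ (λ y → ∃ λ x → φ π p x × (∀ n → y n ≡ x (Inverse.to P n)))

PermutationInvariant : (List ℕ → Cond) → Set
PermutationInvariant π =
  (P : ℕ → ℕ ↔ ℕ) → Σ Automorphism λ a → ∀ p →
    φ π (to a p) ≐ (λ y → ∃ λ x → φ π p x × (∀ n → y n ≡ Inverse.to (P n) (x n)))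

StrictlyIncreasing : (ℕ → ℕ) → Set
StrictlyIncreasing μ = ∀ m n → m < n → μ m < μ n

-- K ⊆ ω infinite is given via its increasing enumeration μ_K (K = range μ_K).
-- φ(i p) = φ_K(p) × ω^{ω∖K}: y belongs iff y↾K = x ∘ μ_K⁻¹ for some x ∈ φ(p),
-- i.e. y ∘ μ_K = x.
Productive : (List ℕ → Cond) → Set
Productive π =
  (μ : ℕ → ℕ) → StrictlyIncreasing μ →
    Σ (Cond → Cond) λ i → IsCompleteEmbedding i × (∀ p →
      φ π (i p) ≐ (λ y → ∃ λ x → φ π p x × (∀ n → y (μ n) ≡ x n)))

-- Everything about 𝔼 is decided column by column, the k-th column of (z , F) being the
-- pair (z k , F k): a real x lies in φ(p) iff at every k it equals z k where z is defined and
-- avoids the finite set F k elsewhere.  Two conditions are compatible iff they are coherent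
-- in every column (their union is then a common extension), iff some real lies in both φ's
-- (a common extension r has the generic real taking z_r k, or a value above F_r k).  This
-- gives the disjointness criterion, and the basis axioms follow by choosing sequences that
-- the relevant condition admits.  Moving columns along an injection of ω, with empty columns
-- off its range, and relabelling the values of each column by a permutation act on φ as
-- required; for a permutation of ω the move is an automorphism, and for the increasing
-- enumeration of K it is a complete embedding, a condition being reduced by reading it back
-- along the enumeration.
{-# OPTIONS --safe #-}
module Submission where

open import Defs
open import Data.Product using (_×_)
open import Data.Empty using (⊥)
open import Function.Bundles using (_⇔_)

open import Data.Empty using (⊥-elim)
open import Data.Fin using (Fin; toℕ; fromℕ<)
open import Data.Fin.Properties using (any?; toℕ-fromℕ<)
open import Data.List using (List; []; _∷_; _++_; [_]; length; map; upTo; applyUpTo)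
open import Data.List.Extrema.Nat using (max; xs≤max)
open import Data.List.Membership.Propositional using (_∈_; _∉_)
open import Data.List.Membership.Propositional.Properties
  using (∈-map⁺; ∈-map⁻; ∈-++⁺ˡ; ∈-++⁺ʳ; ∈-upTo⁺)
open import Data.List.Relation.Binary.Subset.Propositional.Properties using (map⁺)
open import Data.List.Properties using (map-upTo; length-++; length-map)
import Data.List.Properties as List
import Data.List.Relation.Unary.All as All
open import Data.Maybe using (Maybe; just; nothing; _<∣>_; maybe′; fromMaybe)
import Data.Maybe as Maybe
open import Data.Maybe.Properties using (just-injective)
import Data.Maybe.Properties as MaybeP
open import Data.Nat using (ℕ; zero; suc; _+_; _≤_; _<_; z≤n; s≤s; _≟_; _<?_)
open import Data.Nat.Properties
  using (≤-refl; ≤-trans; <-irrefl; <⇒≱; ≮⇒≥; <-cmp; m≤m+n; m≤n+m; +-mono-≤; n<1+n)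
open import Data.Product using (∃; _,_; proj₁; proj₂; map₂; swap)
open import Data.Sum using (_⊎_; inj₁; inj₂)
open import Data.Unit using (⊤; tt)
open import Function using (_∘_; Injective)
open import Function.Bundles using (Inverse; Injection; mk⇔)
open import Function.Properties.Inverse using (↔-sym; ↔⇒↣)
open import Relation.Binary.Definitions using (tri<; tri≈; tri>)
open import Relation.Binary.PropositionalEquality
  using (_≡_; refl; sym; trans; cong; cong₂; subst; subst₂; _≗_)
open import Relation.Nullary using (yes; no)

Column : Set
Column = Maybe ℕ × List ℕ

column : Cond → ℕ → Column
column p k = z p k , F p k

Admits : Column → ℕ → Set
Admits (just w  , _) v = v ≡ w
Admits (nothing , l) v = v ∉ l

Coherent : Column → Column → Set
Coherent (just v  , _) c             = Admits c v
Coherent (nothing , l) (just w  , _) = w ∉ l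
Coherent (nothing , _) (nothing , _) = ⊤

infix 4 _≼_
_≼_ : Column → Column → Set
(o , l) ≼ (o′ , l′) =
    (∀ v → o ≡ just v → o′ ≡ just v)
  × (∀ x → x ∈ l → x ∈ l′)
  × (∀ v → o′ ≡ just v → o ≡ nothing → v ∉ l)

infixl 6 _⊔_
_⊔_ : Column → Column → Column
(o , l) ⊔ (o′ , l′) = o <∣> o′ , l ++ l′

≼-refl : ∀ {c} → c ≼ c
≼-refl = (λ _ e → e) , (λ _ m → m) , λ { _ refl () }

≼-bottom : ∀ {c} → (nothing , []) ≼ c
≼-bottom = (λ _ ()) , (λ _ ()) , λ _ _ _ ()

≼-trans : ∀ {c c′ c″} → c ≼ c′ → c′ ≼ c″ → c ≼ c″
≼-trans {o , l} {just w , _} (e , s , a) (e′ , s′ , _) =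
  (λ v → e′ v ∘ e v) , (λ x → s′ x ∘ s x) ,
  λ v o″≡v o≡∅ v∈l → a w refl o≡∅ (subst (_∈ l) (just-injective (trans (sym o″≡v) (e′ w refl))) v∈l)
≼-trans {o , l} {nothing , _} (e , s , a) (e′ , s′ , a′) =
  (λ v → e′ v ∘ e v) , (λ x → s′ x ∘ s x) ,
  λ v o″≡v _ v∈l → a′ v o″≡v refl (s v v∈l)

admits-value : ∀ c {v} → proj₁ c ≡ just v → Admits c v
admits-value (just _ , _) refl = refl

admits-antitone : ∀ c c′ {v} → c ≼ c′ → Admits c′ v → Admits c v
admits-antitone (just w , _) (o′ , l′) {v} (e , _ , _) a = subst (λ o → Admits (o , l′) v) (e w refl) a
admits-antitone (nothing , _) (just w , _) (_ , _ , a) refl = a w refl refl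
admits-antitone (nothing , _) (nothing , _) (_ , s , _) a = a ∘ s _

admits-of-coherent : ∀ c c′ {v} → Coherent c c′ → proj₁ c ≡ just v → Admits c′ v
admits-of-coherent (just _ , _) _ h refl = h

coherent-of-admits : ∀ c c′ {v} → Admits c v → Admits c′ v → Coherent c c′
coherent-of-admits (just _ , _) c′ refl a′ = a′
coherent-of-admits (nothing , _) (just _ , _) a refl = a
coherent-of-admits (nothing , _) (nothing , _) _ _ = tt

coherent-bottom : ∀ c → Coherent (nothing , []) c
coherent-bottom (just _ , _) = λ ()
coherent-bottom (nothing , _) = tt

coherent-bare : ∀ o c → (∀ v → o ≡ just v → Admits c v) → Coherent (o , []) c
coherent-bare (just v) c h = h v refl
coherent-bare nothing c _ = coherent-bottom c

≼-⊔ˡ : ∀ c c′ → Coherent c c′ → c ≼ c ⊔ c′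
≼-⊔ˡ (just _ , _) _ _ = (λ _ e → e) , (λ _ → ∈-++⁺ˡ) , λ _ _ ()
≼-⊔ˡ (nothing , _) (just _ , _) h = (λ _ ()) , (λ _ → ∈-++⁺ˡ) , λ { _ refl _ → h }
≼-⊔ˡ (nothing , _) (nothing , _) _ = (λ _ ()) , (λ _ → ∈-++⁺ˡ) , λ _ ()

≼-⊔ʳ : ∀ c c′ → Coherent c c′ → c′ ≼ c ⊔ c′
≼-⊔ʳ (just _ , l) (just _ , _) h = (λ { _ refl → cong just h }) , (λ _ → ∈-++⁺ʳ l) , λ _ _ ()
≼-⊔ʳ (just _ , l) (nothing , _) h = (λ _ ()) , (λ _ → ∈-++⁺ʳ l) , λ { _ refl _ → h }
≼-⊔ʳ (nothing , l) (just _ , _) _ = (λ _ e → e) , (λ _ → ∈-++⁺ʳ l) , λ _ _ ()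
≼-⊔ʳ (nothing , l) (nothing , _) _ = (λ _ ()) , (λ _ → ∈-++⁺ʳ l) , λ _ ()

fresh : List ℕ → ℕ
fresh l = suc (max 0 l)

<-fresh : ∀ {x l} → x ∈ l → x < fresh l
<-fresh {l = l} x∈l = s≤s (All.lookup (xs≤max 0 l) x∈l)

fresh-∉ : ∀ l → fresh l ∉ l
fresh-∉ l m = <-irrefl refl (<-fresh m)

pick : Column → ℕ
pick (just v  , _) = v
pick (nothing , l) = fresh l

pick-admitted : ∀ c → Admits c (pick c)
pick-admitted (just _  , _) = refl
pick-admitted (nothing , l) = fresh-∉ l

-- Compatibility and the reals through a condition

≤E⇒≼ : ∀ p q → p ≤E q → ∀ k → column p k ≼ column q k
≤E⇒≼ _ _ (e , s , a) k = e k , s k , a k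

≼⇒≤E : ∀ p q → (∀ k → column p k ≼ column q k) → p ≤E q
≼⇒≤E _ _ h = (λ k → proj₁ (h k)) , (λ k → proj₁ (proj₂ (h k))) , (λ k → proj₂ (proj₂ (h k)))

≤E-refl : ∀ p → p ≤E p
≤E-refl p = ≼⇒≤E p p (λ _ → ≼-refl)

≤E-trans : ∀ p q r → p ≤E q → q ≤E r → p ≤E r
≤E-trans p q r p≤q q≤r = ≼⇒≤E p r (λ k → ≼-trans (≤E⇒≼ p q p≤q k) (≤E⇒≼ q r q≤r k))

≈E-columnwise : ∀ p q → (∀ k → column p k ≡ column q k) → p ≈E q
≈E-columnwise p q e =
    ≼⇒≤E p q (λ k → subst (column p k ≼_) (e k) ≼-refl)
  , ≼⇒≤E q p (λ k → subst (_≼ column p k) (e k) ≼-refl)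

Consistent : Cond → Cond → Set
Consistent p q = ∀ k → Coherent (column p k) (column q k)

Realises : Cond → (ℕ → ℕ) → Set
Realises p x = ∀ k → Admits (column p k) (x k)

realises-antitone : ∀ p q {x} → p ≤E q → Realises q x → Realises p x
realises-antitone p q p≤q r k = admits-antitone (column p k) (column q k) (≤E⇒≼ p q p≤q k) (r k)

realises-≗ : ∀ p {x y} → x ≗ y → Realises p x → Realises p y
realises-≗ p x≗y r k = subst (Admits (column p k)) (x≗y k) (r k)

generic : Cond → ℕ → ℕ
generic p k = pick (column p k)

generic-realises : ∀ p → Realises p (generic p)
generic-realises p k = pick-admitted (column p k)

FiniteSupport : (ℕ → Maybe ℕ) → Set
FiniteSupport o = ∃ λ N → ∀ n → N ≤ n → o n ≡ nothing

support : Cond → ℕ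
support p = proj₁ (zfin p)

z-beyond-support : ∀ p {k} → support p ≤ k → z p k ≡ nothing
z-beyond-support p = proj₂ (zfin p) _

finiteSupport-transport : ∀ {o} → FiniteSupport o → (g : ℕ → ℕ) (o′ : ℕ → Maybe ℕ) →
  (∀ k → o′ k ≡ nothing ⊎ ∃ λ n → k ≡ g n × o′ k ≡ o n) → FiniteSupport o′
finiteSupport-transport (N , beyond) g o′ located = fresh (map g (upTo N)) , bound
  where
  bound : ∀ k → fresh (map g (upTo N)) ≤ k → o′ k ≡ nothing
  bound k le with located k
  ... | inj₁ o′k≡∅ = o′k≡∅
  ... | inj₂ (n , refl , o′k≡on) with n <? N
  ...   | yes n<N = ⊥-elim (<⇒≱ (<-fresh (∈-map⁺ g (∈-upTo⁺ n<N))) le)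
  ...   | no  n≮N = trans o′k≡on (beyond n (≮⇒≥ n≮N))

amalgam : Cond → Cond → Cond
amalgam p q = cond (λ k → z p k <∣> z q k) (support p + support q , beyond)
                   (λ k → F p k ++ F q k) (proj₁ (Fbd p) + proj₁ (Fbd q) , bounded)
  where
  beyond : ∀ k → support p + support q ≤ k → z p k <∣> z q k ≡ nothing
  beyond k le rewrite z-beyond-support p (≤-trans (m≤m+n _ _) le)
                    | z-beyond-support q (≤-trans (m≤n+m _ _) le) = refl
  bounded : ∀ k → length (F p k ++ F q k) ≤ proj₁ (Fbd p) + proj₁ (Fbd q)
  bounded k rewrite length-++ (F p k) {F q k} = +-mono-≤ (proj₂ (Fbd p) k) (proj₂ (Fbd q) k)

consistent⇒compatible : ∀ p q → Consistent p q → Compat p q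
consistent⇒compatible p q h =
  amalgam p q , ≼⇒≤E p (amalgam p q) (λ k → ≼-⊔ˡ (column p k) (column q k) (h k))
              , ≼⇒≤E q (amalgam p q) (λ k → ≼-⊔ʳ (column p k) (column q k) (h k))

compatible⇒common-realiser : ∀ p q → Compat p q → ∃ λ x → Realises p x × Realises q x
compatible⇒common-realiser p q (r , p≤r , q≤r) = generic r
  , realises-antitone p r p≤r (generic-realises r) , realises-antitone q r q≤r (generic-realises r)

common-realiser⇒consistent : ∀ p q {x} → Realises p x → Realises q x → Consistent p q
common-realiser⇒consistent p q rp rq k = coherent-of-admits (column p k) (column q k) (rp k) (rq k)

compatible⇒consistent : ∀ p q → Compat p q → Consistent p q
compatible⇒consistent p q c with compatible⇒common-realiser p q c
... | _ , rp , rq = common-realiser⇒consistent p q rp rq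

seqFun-applyUpTo : ∀ f {n k} → k < n → seqFun (applyUpTo f n) k ≡ just (f k)
seqFun-applyUpTo f {suc n} {zero}  _         = refl
seqFun-applyUpTo f {suc n} {suc k} (s≤s k<n) = seqFun-applyUpTo (f ∘ suc) k<n

seqFun-applyUpTo-just : ∀ f n {k v} → seqFun (applyUpTo f n) k ≡ just v → v ≡ f k
seqFun-applyUpTo-just f (suc n) {zero}  refl = refl
seqFun-applyUpTo-just f (suc n) {suc k} e    = seqFun-applyUpTo-just (f ∘ suc) n e

seqFun-restrict : ∀ x {n k} → k < n → seqFun (restrict x n) k ≡ just (x k)
seqFun-restrict x {n} {k} k<n =
  subst (λ s → seqFun s k ≡ just (x k)) (sym (map-upTo x n)) (seqFun-applyUpTo x k<n)

seqFun-restrict-just : ∀ x n {k v} → seqFun (restrict x n) k ≡ just v → v ≡ x k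
seqFun-restrict-just x n {k} {v} =
  seqFun-applyUpTo-just x n ∘ subst (λ s → seqFun s k ≡ just v) (map-upTo x n)

seqFun-++ˡ : ∀ s t {k v} → seqFun s k ≡ just v → seqFun (s ++ t) k ≡ just v
seqFun-++ˡ (_ ∷ _) t {zero}  e = e
seqFun-++ˡ (_ ∷ s) t {suc k} e = seqFun-++ˡ s t e

seqFun-last : ∀ s n → seqFun (s ++ [ n ]) (length s) ≡ just n
seqFun-last []      n = refl
seqFun-last (_ ∷ s) n = seqFun-last s n

seqFun-snoc-just : ∀ s n {k v} → seqFun (s ++ [ n ]) k ≡ just v →
                   seqFun s k ≡ just v ⊎ (k ≡ length s × v ≡ n)
seqFun-snoc-just []      n {zero}  refl = inj₂ (refl , refl)
seqFun-snoc-just (_ ∷ _) n {zero}  e    = inj₁ e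
seqFun-snoc-just (_ ∷ s) n {suc k} e with seqFun-snoc-just s n e
... | inj₁ e′           = inj₁ e′
... | inj₂ (refl , v≡n) = inj₂ (refl , v≡n)

AdmitsEntries : Cond → List ℕ → Set
AdmitsEntries p s = ∀ k v → seqFun s k ≡ just v → Admits (column p k) v

compatible-πE⇒admits : ∀ s p → Compat (πE s) p → AdmitsEntries p s
compatible-πE⇒admits s p c k v =
  admits-of-coherent (seqFun s k , []) (column p k) (compatible⇒consistent (πE s) p c k)

admits⇒compatible-πE : ∀ s p → AdmitsEntries p s → Compat (πE s) p
admits⇒compatible-πE s p h =
  consistent⇒compatible (πE s) p (λ k → coherent-bare (seqFun s k) (column p k) (h k))

compatible-restrict⇒admits : ∀ x n p {k} → Compat (πE (restrict x n)) p → k < n →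
                             Admits (column p k) (x k)
compatible-restrict⇒admits x n p {k} c k<n =
  compatible-πE⇒admits (restrict x n) p c k (x k) (seqFun-restrict x k<n)

φ⇒realises : ∀ p x → φ πE p x → Realises p x
φ⇒realises p x h k = compatible-restrict⇒admits x (suc k) p (h (suc k)) (n<1+n k)

realises⇒φ : ∀ p x → Realises p x → φ πE p x
realises⇒φ p x r n = admits⇒compatible-πE (restrict x n) p λ k v e →
  subst (Admits (column p k)) (sym (seqFun-restrict-just x n e)) (r k)

disjoint⇔incompatible : ∀ p q → (∀ x → φ πE p x → φ πE q x → ⊥) ⇔ Incompat p q
disjoint⇔incompatible p q = mk⇔ disjoint⇒incompatible incompatible⇒disjoint
  where
  disjoint⇒incompatible : (∀ x → φ πE p x → φ πE q x → ⊥) → Incompat p q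
  disjoint⇒incompatible disjoint c with compatible⇒common-realiser p q c
  ... | x , rp , rq = disjoint x (realises⇒φ p x rp) (realises⇒φ q x rq)
  incompatible⇒disjoint : Incompat p q → ∀ x → φ πE p x → φ πE q x → ⊥
  incompatible⇒disjoint p⊥q x hp hq = p⊥q (consistent⇒compatible p q
    (common-realiser⇒consistent p q (φ⇒realises p x hp) (φ⇒realises q x hq)))

-- The basis

πE-maximal : ∀ s q → πE s ≤E q → ∃ λ n → Compat q (πE (s ++ [ n ]))
πE-maximal s q (s⊆zq , _ , _) = n , map₂ swap (admits⇒compatible-πE (s ++ [ n ]) q entries)
  where
  n : ℕ
  n = generic q (length s)
  entries : AdmitsEntries q (s ++ [ n ])
  entries k v e with seqFun-snoc-just s n e
  ... | inj₁ e′             = admits-value (column q k) (s⊆zq k v e′)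
  ... | inj₂ (refl , refl) = generic-realises q (length s)

-- The generic real of q, cut off beyond both supports, already meets q and refutes p.
πE-generators : ∀ p q → Incompat q p → ∃ λ s → Incompat (πE s) p × Compat (πE s) q
πE-generators p q q⊥p = restrict x N , segment⊥p , realises⇒φ q x (generic-realises q) N
  where
  x : ℕ → ℕ
  x = generic q
  N : ℕ
  N = support p + support q
  segment⊥p : Incompat (πE (restrict x N)) p
  segment⊥p c = q⊥p (consistent⇒compatible q p coherent)
    where
    coherent : Consistent q p
    coherent k with k <? N
    ... | yes k<N = coherent-of-admits (column q k) (column p k)
                      (generic-realises q k) (compatible-restrict⇒admits x N p c k<N)
    ... | no  k≮N rewrite z-beyond-support q (≤-trans (m≤n+m _ _) (≮⇒≥ k≮N))
                        | z-beyond-support p (≤-trans (m≤m+n _ _) (≮⇒≥ k≮N)) = tt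

πE-isBasis : IsBasis πE
πE-isBasis = record
  { root       = ≤E-refl emptyCond , ≤E-refl emptyCond
  ; above      = λ s n → (λ k v → seqFun-++ˡ s [ n ] {k}) , (λ _ _ ()) , λ _ _ _ _ ()
  ; pairwise   = λ s n m n≢m (r , (sn⊆r , _) , (sm⊆r , _)) → n≢m (just-injective
                   (trans (sym (sn⊆r _ n (seqFun-last s n))) (sm⊆r _ m (seqFun-last s m))))
  ; maximal    = πE-maximal
  ; generators = πE-generators
  }

-- Moving columns along an injection of ω

automorphism : (f g : Cond → Cond) →
  (∀ p q → p ≤E q → f p ≤E f q) → (∀ p q → p ≤E q → g p ≤E g q) →
  (∀ p → f (g p) ≈E p) → (∀ p → g (f p) ≈E p) → Automorphism
automorphism f g f-mono g-mono f∘g g∘f = record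
  { to = f ; from = g ; to-from = f∘g ; from-to = g∘f ; mono = f-mono
  ; reflect = λ p q fp≤fq →
      ≤E-trans p (g (f p)) q (proj₂ (g∘f p))
        (≤E-trans (g (f p)) (g (f q)) q (g-mono (f p) (f q) fp≤fq) (proj₁ (g∘f q)))
  }

-- τ is an injective map of coordinates and σ its partial inverse, defined exactly on the range of τ.
-- push p carries column n of p to column τ n and is empty off the range of τ; pull reads it back.
module Reindexing (τ : ℕ → ℕ) (σ : ℕ → Maybe ℕ)
                  (σ∘τ : ∀ n → σ (τ n) ≡ just n) (τ∘σ : ∀ {k n} → σ k ≡ just n → τ n ≡ k) where

  pushedColumn : Cond → ℕ → Column
  pushedColumn p k = maybe′ (column p) (nothing , []) (σ k)

  pushedColumn-image : ∀ p n → pushedColumn p (τ n) ≡ column p n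
  pushedColumn-image p n = cong (maybe′ (column p) (nothing , [])) (σ∘τ n)

  pushedColumn-elim : ∀ p (P : ℕ → Column → Set) →
    (∀ n → P (τ n) (column p n)) → (∀ k → σ k ≡ nothing → P k (nothing , [])) →
    ∀ k → P k (pushedColumn p k)
  pushedColumn-elim p P image outside k = go (σ k) refl
    where
    go : ∀ o → σ k ≡ o → P k (maybe′ (column p) (nothing , []) o)
    go (just n) σk≡n = subst (λ k′ → P k′ (column p n)) (τ∘σ σk≡n) (image n)
    go nothing  σk≡∅ = outside k σk≡∅

  push : Cond → Cond
  push p = cond (proj₁ ∘ pushedColumn p) support′ (proj₂ ∘ pushedColumn p) (proj₁ (Fbd p) , bounded)
    where
    support′ : FiniteSupport (proj₁ ∘ pushedColumn p)
    support′ = finiteSupport-transport (zfin p) τ (proj₁ ∘ pushedColumn p)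
      (pushedColumn-elim p (λ k c → proj₁ c ≡ nothing ⊎ ∃ λ n → k ≡ τ n × proj₁ c ≡ z p n)
        (λ n → inj₂ (n , refl , refl)) (λ _ _ → inj₁ refl))
    bounded : ∀ k → length (proj₂ (pushedColumn p k)) ≤ proj₁ (Fbd p)
    bounded = pushedColumn-elim p (λ _ c → length (proj₂ c) ≤ proj₁ (Fbd p))
      (proj₂ (Fbd p)) (λ _ _ → z≤n)

  pull : Cond → Cond
  pull q = cond (z q ∘ τ) support′ (F q ∘ τ) (proj₁ (Fbd q) , proj₂ (Fbd q) ∘ τ)
    where
    support′ : FiniteSupport (z q ∘ τ)
    support′ = finiteSupport-transport (zfin q) (fromMaybe 0 ∘ σ) (z q ∘ τ)
      (λ n → inj₂ (τ n , cong (fromMaybe 0) (sym (σ∘τ n)) , refl))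

  push-mono : ∀ p q → p ≤E q → push p ≤E push q
  push-mono p q p≤q = ≼⇒≤E (push p) (push q) (pushedColumn-elim p (λ k c → c ≼ pushedColumn q k)
    (λ n → subst (column p n ≼_) (sym (pushedColumn-image q n)) (≤E⇒≼ p q p≤q n)) (λ _ _ → ≼-bottom))

  pull-mono : ∀ p q → p ≤E q → pull p ≤E pull q
  pull-mono p q p≤q = ≼⇒≤E (pull p) (pull q) (≤E⇒≼ p q p≤q ∘ τ)

  pull-push : ∀ p → pull (push p) ≈E p
  pull-push p = ≈E-columnwise (pull (push p)) p (pushedColumn-image p)

  push-pull : (∀ k → ∃ λ n → τ n ≡ k) → ∀ q → push (pull q) ≈E q
  push-pull onto q = ≈E-columnwise (push (pull q)) q
    (pushedColumn-elim (pull q) (λ k c → c ≡ column q k) (λ _ → refl) off-range)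
    where
    off-range : ∀ k → σ k ≡ nothing → (nothing , []) ≡ column q k
    off-range k σk≡∅ with onto k
    ... | n , refl with () ← trans (sym (σ∘τ n)) σk≡∅

  push-incompat : ∀ p q → Incompat p q → Incompat (push p) (push q)
  push-incompat p q p⊥q c = p⊥q (consistent⇒compatible p q λ n →
    subst₂ Coherent (pushedColumn-image p n) (pushedColumn-image q n)
      (compatible⇒consistent (push p) (push q) c (τ n)))

  push-reduction : ∀ q p → pull q ≤E p → Compat (push p) q
  push-reduction q p q≤p = consistent⇒compatible (push p) q
    (pushedColumn-elim p (λ k c → Coherent c (column q k))
      (compatible⇒consistent p (pull q) (p , ≤E-refl p , q≤p))
      (λ k _ → coherent-bottom (column q k)))

  push-isCompleteEmbedding : IsCompleteEmbedding push
  push-isCompleteEmbedding = record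
    { mono = push-mono ; incompat = push-incompat ; reduction = λ q → pull q , push-reduction q }

  realises-push⇒ : ∀ p y → Realises (push p) y → Realises p (y ∘ τ)
  realises-push⇒ p y r n = subst (λ c → Admits c (y (τ n))) (pushedColumn-image p n) (r (τ n))

  realises-push⇐ : ∀ p y → Realises p (y ∘ τ) → Realises (push p) y
  realises-push⇐ p y r = pushedColumn-elim p (λ k c → Admits c (y k)) r (λ _ _ ())

πE-indexInvariant : IndexInvariant πE
πE-indexInvariant P = automorphism push pull push-mono pull-mono (push-pull onto) pull-push , φ-push
  where
  open Inverse P using (strictlyInverseˡ; strictlyInverseʳ) renaming (to to P⁺; from to P⁻)
  P⁻-undoes-P⁺ : ∀ {k n} → just (P⁺ k) ≡ just n → P⁻ n ≡ k
  P⁻-undoes-P⁺ {k} refl = strictlyInverseʳ k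
  open Reindexing P⁻ (just ∘ P⁺) (cong just ∘ strictlyInverseˡ) P⁻-undoes-P⁺
  onto : ∀ k → ∃ λ n → P⁻ n ≡ k
  onto k = P⁺ k , strictlyInverseʳ k
  φ-push : ∀ p → φ πE (push p) ≐ (λ y → ∃ λ x → φ πE p x × (∀ n → y n ≡ x (P⁺ n)))
  φ-push p y = forward , backward
    where
    forward : φ πE (push p) y → ∃ λ x → φ πE p x × (∀ n → y n ≡ x (P⁺ n))
    forward h = y ∘ P⁻ , realises⇒φ p (y ∘ P⁻) (realises-push⇒ p y (φ⇒realises (push p) y h))
              , λ n → cong y (sym (strictlyInverseʳ n))
    backward : (∃ λ x → φ πE p x × (∀ n → y n ≡ x (P⁺ n))) → φ πE (push p) y
    backward (x , hx , y≡x∘P⁺) =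
      realises⇒φ (push p) y (realises-push⇐ p y (realises-≗ p x≗y∘P⁻ (φ⇒realises p x hx)))
      where
      x≗y∘P⁻ : x ≗ y ∘ P⁻
      x≗y∘P⁻ m = trans (cong x (sym (strictlyInverseˡ m))) (sym (y≡x∘P⁺ (P⁻ m)))

module _ {μ : ℕ → ℕ} (μ-increasing : StrictlyIncreasing μ) where

  increasing-injective : ∀ {m n} → μ m ≡ μ n → m ≡ n
  increasing-injective {m} {n} μm≡μn with <-cmp m n
  ... | tri< m<n _ _ = ⊥-elim (<-irrefl μm≡μn (μ-increasing m n m<n))
  ... | tri≈ _ m≡n _ = m≡n
  ... | tri> _ _ n<m = ⊥-elim (<-irrefl (sym μm≡μn) (μ-increasing n m n<m))

  increasing-inflationary : ∀ n → n ≤ μ n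
  increasing-inflationary zero    = z≤n
  increasing-inflationary (suc n) =
    ≤-trans (s≤s (increasing-inflationary n)) (μ-increasing n (suc n) ≤-refl)

preimage : (ℕ → ℕ) → ℕ → Maybe ℕ
preimage μ k with any? (λ (i : Fin (suc k)) → μ (toℕ i) ≟ k)
... | yes (i , _) = just (toℕ i)
... | no _        = nothing

preimage-sound : ∀ μ {k n} → preimage μ k ≡ just n → μ n ≡ k
preimage-sound μ {k} e with any? (λ (i : Fin (suc k)) → μ (toℕ i) ≟ k)
... | yes (i , μi≡k) = subst (λ n → μ n ≡ k) (just-injective e) μi≡k

-- For increasing μ the preimage of μ n is searched among 0 … μ n, a range containing n.
preimage-complete : ∀ {μ} → StrictlyIncreasing μ → ∀ n → preimage μ (μ n) ≡ just n
preimage-complete {μ} μ-increasing n with any? (λ (i : Fin (suc (μ n))) → μ (toℕ i) ≟ μ n)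
... | yes (i , μi≡μn) = cong just (increasing-injective μ-increasing μi≡μn)
... | no  ∄i          =
  ⊥-elim (∄i (fromℕ< n<1+μn , subst (λ m → μ m ≡ μ n) (sym (toℕ-fromℕ< n<1+μn)) refl))
  where
  n<1+μn : n < suc (μ n)
  n<1+μn = s≤s (increasing-inflationary μ-increasing n)

πE-productive : Productive πE
πE-productive μ μ-increasing = push , push-isCompleteEmbedding , φ-push
  where
  open Reindexing μ (preimage μ) (preimage-complete μ-increasing) (preimage-sound μ)
  φ-push : ∀ p → φ πE (push p) ≐ (λ y → ∃ λ x → φ πE p x × (∀ n → y (μ n) ≡ x n))
  φ-push p y = forward , backward
    where
    forward : φ πE (push p) y → ∃ λ x → φ πE p x × (∀ n → y (μ n) ≡ x n)
    forward h = y ∘ μ , realises⇒φ p (y ∘ μ) (realises-push⇒ p y (φ⇒realises (push p) y h)) , λ _ → refl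
    backward : (∃ λ x → φ πE p x × (∀ n → y (μ n) ≡ x n)) → φ πE (push p) y
    backward (x , hx , y∘μ≡x) =
      realises⇒φ (push p) y (realises-push⇐ p y (realises-≗ p (sym ∘ y∘μ≡x) (φ⇒realises p x hx)))

-- Relabelling values

mapColumn : (ℕ → ℕ) → Column → Column
mapColumn g (o , l) = Maybe.map g o , map g l

module _ {g : ℕ → ℕ} (g-injective : Injective _≡_ _≡_ g) where

  ∈-map-injective : ∀ {v l} → g v ∈ map g l → v ∈ l
  ∈-map-injective m with ∈-map⁻ g m
  ... | u , u∈l , gv≡gu = subst (_∈ _) (sym (g-injective gv≡gu)) u∈l

  mapColumn-mono : ∀ {c c′} → c ≼ c′ → mapColumn g c ≼ mapColumn g c′
  mapColumn-mono {just v , _} {o′ , _} (e , s , _) =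
    (λ { _ refl → cong (Maybe.map g) (e v refl) }) , (λ _ → map⁺ g (λ {x} → s x)) , λ _ _ ()
  mapColumn-mono {nothing , _} {just v′ , _} (_ , s , a) =
    (λ _ ()) , (λ _ → map⁺ g (λ {x} → s x)) ,
    λ { _ refl refl gv′∈gl → a v′ refl refl (∈-map-injective gv′∈gl) }
  mapColumn-mono {nothing , _} {nothing , _} (_ , s , _) =
    (λ _ ()) , (λ _ → map⁺ g (λ {x} → s x)) , λ _ ()

  admits-mapColumn⁺ : ∀ c {v} → Admits c v → Admits (mapColumn g c) (g v)
  admits-mapColumn⁺ (just _  , _) refl = refl
  admits-mapColumn⁺ (nothing , _) v∉l  = v∉l ∘ ∈-map-injective

  admits-mapColumn⁻ : ∀ c {v} → Admits (mapColumn g c) (g v) → Admits c v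
  admits-mapColumn⁻ (just _  , _) gv≡gw = g-injective gv≡gw
  admits-mapColumn⁻ (nothing , _) gv∉gl = gv∉gl ∘ ∈-map⁺ g

mapColumn-inverse : ∀ {f g : ℕ → ℕ} → (∀ v → g (f v) ≡ v) → ∀ c → mapColumn g (mapColumn f c) ≡ c
mapColumn-inverse g∘f (o , l) = cong₂ _,_
  (trans (sym (MaybeP.map-∘ o)) (trans (MaybeP.map-cong g∘f o) (MaybeP.map-id o)))
  (trans (sym (List.map-∘ l)) (trans (List.map-cong g∘f l) (List.map-id l)))

relabel : (ℕ → ℕ → ℕ) → Cond → Cond
relabel f p = cond (λ k → Maybe.map (f k) (z p k)) (support p , beyond)
                   (λ k → map (f k) (F p k)) (proj₁ (Fbd p) , bounded)
  where
  beyond : ∀ k → support p ≤ k → Maybe.map (f k) (z p k) ≡ nothing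
  beyond k le = cong (Maybe.map (f k)) (z-beyond-support p le)
  bounded : ∀ k → length (map (f k) (F p k)) ≤ proj₁ (Fbd p)
  bounded k = subst (_≤ proj₁ (Fbd p)) (sym (length-map (f k) (F p k))) (proj₂ (Fbd p) k)

module _ (f : ℕ → ℕ → ℕ) (f-injective : ∀ k → Injective _≡_ _≡_ (f k)) where

  relabel-mono : ∀ p q → p ≤E q → relabel f p ≤E relabel f q
  relabel-mono p q p≤q =
    ≼⇒≤E (relabel f p) (relabel f q) (λ k → mapColumn-mono (f-injective k) (≤E⇒≼ p q p≤q k))

  realises-relabel⁺ : ∀ p {x} → Realises p x → Realises (relabel f p) (λ k → f k (x k))
  realises-relabel⁺ p r k = admits-mapColumn⁺ (f-injective k) (column p k) (r k)

  realises-relabel⁻ : ∀ p {x} → Realises (relabel f p) (λ k → f k (x k)) → Realises p x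
  realises-relabel⁻ p r k = admits-mapColumn⁻ (f-injective k) (column p k) (r k)

relabel-inverse : ∀ {f g} → (∀ k v → g k (f k v) ≡ v) → ∀ p → relabel g (relabel f p) ≈E p
relabel-inverse {f} {g} g∘f p =
  ≈E-columnwise (relabel g (relabel f p)) p (λ k → mapColumn-inverse (g∘f k) (column p k))

πE-permutationInvariant : PermutationInvariant πE
πE-permutationInvariant P = relabel-automorphism , φ-relabel
  where
  P⁺ P⁻ : ℕ → ℕ → ℕ
  P⁺ k = Inverse.to (P k)
  P⁻ k = Inverse.from (P k)
  P⁺-injective : ∀ k → Injective _≡_ _≡_ (P⁺ k)
  P⁺-injective k = Injection.injective (↔⇒↣ (P k))
  P⁻-injective : ∀ k → Injective _≡_ _≡_ (P⁻ k)
  P⁻-injective k = Injection.injective (↔⇒↣ (↔-sym (P k)))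
  relabel-automorphism : Automorphism
  relabel-automorphism = automorphism (relabel P⁺) (relabel P⁻)
    (relabel-mono P⁺ P⁺-injective) (relabel-mono P⁻ P⁻-injective)
    (relabel-inverse (Inverse.strictlyInverseˡ ∘ P)) (relabel-inverse (Inverse.strictlyInverseʳ ∘ P))
  φ-relabel : ∀ p → φ πE (relabel P⁺ p) ≐ (λ y → ∃ λ x → φ πE p x × (∀ n → y n ≡ P⁺ n (x n)))
  φ-relabel p y = forward , backward
    where
    forward : φ πE (relabel P⁺ p) y → ∃ λ x → φ πE p x × (∀ n → y n ≡ P⁺ n (x n))
    forward h = x , realises⇒φ p x (realises-relabel⁻ P⁺ P⁺-injective p
                      (realises-≗ (relabel P⁺ p) y≗P⁺x (φ⇒realises (relabel P⁺ p) y h))) , y≗P⁺x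
      where
      x : ℕ → ℕ
      x k = P⁻ k (y k)
      y≗P⁺x : ∀ k → y k ≡ P⁺ k (x k)
      y≗P⁺x k = sym (Inverse.strictlyInverseˡ (P k) (y k))
    backward : (∃ λ x → φ πE p x × (∀ n → y n ≡ P⁺ n (x n))) → φ πE (relabel P⁺ p) y
    backward (x , hx , y≡P⁺x) = realises⇒φ (relabel P⁺ p) y (realises-≗ (relabel P⁺ p) (sym ∘ y≡P⁺x)
      (realises-relabel⁺ P⁺ P⁺-injective p (φ⇒realises p x hx)))

proposition5p1 : IsBasis πE × IndexInvariant πE × PermutationInvariant πE × Productive πE
    × (∀ p q → (∀ x → φ πE p x → φ πE q x → ⊥) ⇔ Incompat p q)
proposition5p1 =
  πE-isBasis , πE-indexInvariant , πE-permutationInvariant , πE-productive , disjoint⇔incompatible
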